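{- Let $q$ be an odd prime power and let $\gamma,\delta\in\mathbb{F}_{q^2}$ with $\gamma\neq 0$. Then the polynomial $$f(x)=(x^q-x+\delta)^{2q}+\gamma x$$ is a permutation polynomial of $\mathbb{F}_{q^2}$ if and only if $\gamma\in\mathbb{F}_q^*$ and $\mathrm{Tr}_q^{q^2}(\delta)+\mathrm{Tr}_q^{q^2}(\gamma)/4\neq 0$.
   Context: A polynomial over a finite field $\mathbb{F}$ is a permutation polynomial of $\mathbb{F}$ if the map it induces on $\mathbb{F}$ is a bijection. For $x\in\mathbb{F}_{q^2}$, $\mathrm{Tr}_q^{q^2}(x)=x+x^q$. -}

module Defs where

open import Level using (Level; _⊔_) renaming (suc to lsuc)
open import Data.Nat using (ℕ; zero; suc; _^_)
open import Data.Nat.Primality using (Prime)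
open import Data.Fin using (Fin)
open import Data.Product using (_×_; ∃; Σ)
open import Relation.Nullary using (¬_)
open import Relation.Binary.PropositionalEquality using (_≡_)
open import Algebra.Bundles using (CommutativeRing)

IsPrimePower : ℕ → Set
IsPrimePower q = ∃ λ p → ∃ λ k → Prime p × q ≡ p ^ suc k

record FiniteField (c ℓ : Level) (n : ℕ) : Set (lsuc (c ⊔ ℓ)) where
  field
    commRing : CommutativeRing c ℓ
  open CommutativeRing commRing public
  field
    1≉0        : ¬ (1# ≈ 0#)
    _⁻¹        : Carrier → Carrier
    ⁻¹-inverse : ∀ x → ¬ (x ≈ 0#) → (x * (x ⁻¹)) ≈ 1#
    enum       : Fin n → Carrier
    enum-inj   : ∀ i j → enum i ≈ enum j → i ≡ j
    enum-surj  : ∀ x → ∃ λ i → enum i ≈ x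

  infix 8 _^ᶠ_
  _^ᶠ_ : Carrier → ℕ → Carrier
  x ^ᶠ zero  = 1#
  x ^ᶠ suc k = x * (x ^ᶠ k)

  Tr : ℕ → Carrier → Carrier
  Tr q x = x + (x ^ᶠ q)

  4# : Carrier
  4# = 1# + (1# + (1# + 1#))

  IsPermutation : (Carrier → Carrier) → Set (c ⊔ ℓ)
  IsPermutation f = (∀ x y → f x ≈ f y → x ≈ y) × (∀ y → ∃ λ x → f x ≈ y)

{-# OPTIONS --safe #-}
module Submission where

-- Write σ x = x ^ q for the Frobenius involution of F_{q²}, u x = σ x - x (so σ (u x) = - u x)
-- and β = 2 Tr δ + γ. Since (·)^{2q} = (σ ·)², f x = (σ δ - u x)² + γ x.
-- If σ γ = γ, then σ (f x) - f x = (δ² - (σ δ)²) + β · u x, so for β ≠ 0 equal values of f force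
-- equal values of u and then of γ x; an injective self-map of a finite field is onto.
-- Conversely, every σ-antifixed element is a value of u, and for w with σ w ≠ w but σ (β w) = β w
-- this yields an x with f (x + w) = f x. Such a w exists if β = 0 (any non-fixed w: x^q - x has
-- at most q < q² roots) and if σ γ ≠ γ (w = β⁻¹), so a permutation forces σ γ = γ and β ≠ 0.
-- Finally, for σ γ = γ the quantity Tr δ + Tr γ / 4 equals β / 2, and 2 ≠ 0 as q is odd.
-- σ is additive by the freshman's dream in characteristic p, and σ ∘ σ = id as x^{q²} = x.

open import Defs using (FiniteField)
open import Algebra.Bundles using (CommutativeRing; CommutativeMonoid)
import Algebra.Properties.CommutativeMonoid.Sum
open import Data.Nat as ℕ using (ℕ; zero; suc; 2+; _≤_)
import Data.Nat.Properties as ℕ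
open import Data.Nat.Combinatorics using (_C_; nCn≡1; nC1≡n; nCk+nC[k+1]≡[n+1]C[k+1])
open import Data.Nat.Divisibility using (_∣_; divides; >⇒∤; ∣-refl; ∣-trans; ∣m∣n⇒∣m+n; m∣m*n)
open import Data.Nat.Primality using (Prime; euclidsLemma; ¬prime[0]; ¬prime[1])
open import Data.Nat.Tactic.RingSolver using (solve-∀)
import Data.Integer as ℤ
import Data.Integer.Properties as ℤ
import Data.Sign as Sign
open import Data.Fin as Fin using (Fin; zero; suc; toℕ; inject₁; punchOut)
import Data.Fin.Properties as Fin
open import Data.Fin.Permutation using (Permutation; permutation)
open import Data.List using (List; []; _∷_; length; replicate)
import Data.List.Properties as List
open import Data.Maybe using (Maybe; just; nothing)
open import Data.Product using (∃; _,_; proj₁; proj₂)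
import Data.Product as Product
open import Data.Sum using (_⊎_; inj₁; inj₂; [_,_]′)
open import Data.Vec.Functional using (Vector; removeAt)
open import Function using (_∘_; id)
open import Function.Definitions using (Injective)
open import Relation.Binary using (Decidable; _Preserves_⟶_)
open import Relation.Binary.PropositionalEquality as ≡ using (_≡_; _≢_)
open import Relation.Nullary using (¬_; yes; no; ¬?; contradiction)
open import Relation.Nullary.Decidable using (decidable-stable)

module IntegerCoefficients {c ℓ} (R : CommutativeRing c ℓ) where
  open import Data.Integer using (ℤ; +_; -[1+_]; _⊖_)
  open CommutativeRing R
  open import Algebra.Properties.Ring ring
    using (-0#≈0#; -‿involutive; -‿+-comm; -‿distribˡ-*; -‿distribʳ-*)
  open import Algebra.Properties.Semiring.Mult.TCOptimised semiring
    using (_×_; 1+×; ×-homo-+; ×1-homo-*)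
  open import Algebra.Properties.CommutativeSemigroup +-commutativeSemigroup
    using (interchange)
  open import Algebra.Solver.Ring.AlmostCommutativeRing
    using (fromCommutativeRing; _-Raw-AlmostCommutative⟶_)
  open import Relation.Binary.Reasoning.Setoid setoid

  -- The optimised _×_ makes 1 × 1# and 2 × 1# reduce to 1# and 1# + 1#, so numerals in solver
  -- equations match the ring's own terms.
  fromℕ : ℕ → Carrier
  fromℕ n = n × 1#

  fromℤ : ℤ → Carrier
  fromℤ (+ n)    = fromℕ n
  fromℤ -[1+ n ] = - fromℕ (suc n)

  fromℤ-⊖ : ∀ m n → fromℤ (m ⊖ n) ≈ fromℕ m - fromℕ n
  fromℤ-⊖ zero    zero    = sym (-‿inverseʳ 0#)
  fromℤ-⊖ (suc m) zero    = sym (trans (+-congˡ -0#≈0#) (+-identityʳ _))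
  fromℤ-⊖ zero    (suc n) = sym (+-identityˡ _)
  fromℤ-⊖ (suc m) (suc n) = begin
    fromℤ (suc m ⊖ suc n)               ≡⟨ ≡.cong fromℤ (ℤ.[1+m]⊖[1+n]≡m⊖n m n) ⟩
    fromℤ (m ⊖ n)                       ≈⟨ fromℤ-⊖ m n ⟩
    fromℕ m - fromℕ n                   ≈⟨ +-identityˡ _ ⟨
    0# + (fromℕ m - fromℕ n)            ≈⟨ +-congʳ (-‿inverseʳ 1#) ⟨
    (1# - 1#) + (fromℕ m - fromℕ n)     ≈⟨ interchange 1# (- 1#) (fromℕ m) (- fromℕ n) ⟩
    (1# + fromℕ m) + (- 1# - fromℕ n)   ≈⟨ +-cong (1+× m 1#) (sym (-‿+-comm 1# (fromℕ n))) ⟨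
    fromℕ (suc m) - (1# + fromℕ n)      ≈⟨ +-congˡ (-‿cong (1+× n 1#)) ⟨
    fromℕ (suc m) - fromℕ (suc n)       ∎

  fromℤ-+ : ∀ i j → fromℤ (i ℤ.+ j) ≈ fromℤ i + fromℤ j
  fromℤ-+ (+ m)    (+ n)    = ×-homo-+ 1# m n
  fromℤ-+ (+ m)    -[1+ n ] = fromℤ-⊖ m (suc n)
  fromℤ-+ -[1+ m ] (+ n)    = trans (fromℤ-⊖ n (suc m)) (+-comm _ _)
  fromℤ-+ -[1+ m ] -[1+ n ] = begin
    - fromℕ (suc (suc (m ℕ.+ n)))           ≡⟨ ≡.cong (-_ ∘ fromℕ ∘ suc) (ℕ.+-suc m n) ⟨
    - fromℕ (suc m ℕ.+ suc n)               ≈⟨ -‿cong (×-homo-+ 1# (suc m) (suc n)) ⟩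
    - (fromℕ (suc m) + fromℕ (suc n))       ≈⟨ -‿+-comm _ _ ⟨
    - fromℕ (suc m) - fromℕ (suc n)         ∎

  fromℤ-◃+ : ∀ n → fromℤ (Sign.+ ℤ.◃ n) ≈ fromℕ n
  fromℤ-◃+ zero    = refl
  fromℤ-◃+ (suc n) = refl

  fromℤ-◃- : ∀ n → fromℤ (Sign.- ℤ.◃ n) ≈ - fromℕ n
  fromℤ-◃- zero    = sym -0#≈0#
  fromℤ-◃- (suc n) = refl

  fromℤ-* : ∀ i j → fromℤ (i ℤ.* j) ≈ fromℤ i * fromℤ j
  fromℤ-* (+ m)    (+ n)    = trans (fromℤ-◃+ (m ℕ.* n)) (×1-homo-* m n)
  fromℤ-* (+ m)    -[1+ n ] = begin
    fromℤ (Sign.- ℤ.◃ (m ℕ.* suc n))        ≈⟨ fromℤ-◃- (m ℕ.* suc n) ⟩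
    - fromℕ (m ℕ.* suc n)                   ≈⟨ -‿cong (×1-homo-* m (suc n)) ⟩
    - (fromℕ m * fromℕ (suc n))             ≈⟨ -‿distribʳ-* _ _ ⟩
    fromℕ m * - fromℕ (suc n)               ∎
  fromℤ-* -[1+ m ] (+ n)    = begin
    fromℤ (Sign.- ℤ.◃ (suc m ℕ.* n))        ≈⟨ fromℤ-◃- (suc m ℕ.* n) ⟩
    - fromℕ (suc m ℕ.* n)                   ≈⟨ -‿cong (×1-homo-* (suc m) n) ⟩
    - (fromℕ (suc m) * fromℕ n)             ≈⟨ -‿distribˡ-* _ _ ⟩
    - fromℕ (suc m) * fromℕ n               ∎
  fromℤ-* -[1+ m ] -[1+ n ] = begin
    fromℕ (suc m ℕ.* suc n)                 ≈⟨ ×1-homo-* (suc m) (suc n) ⟩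
    fromℕ (suc m) * fromℕ (suc n)           ≈⟨ -‿involutive _ ⟨
    - - (fromℕ (suc m) * fromℕ (suc n))     ≈⟨ -‿cong (-‿distribˡ-* _ _) ⟩
    - (- fromℕ (suc m) * fromℕ (suc n))     ≈⟨ -‿distribʳ-* _ _ ⟩
    - fromℕ (suc m) * - fromℕ (suc n)       ∎

  fromℤ-neg : ∀ i → fromℤ (ℤ.- i) ≈ - fromℤ i
  fromℤ-neg (+ zero)  = sym -0#≈0#
  fromℤ-neg (+ suc n) = refl
  fromℤ-neg -[1+ n ]  = sym (-‿involutive _)

  fromℤ-homomorphism : CommutativeRing.rawRing ℤ.+-*-commutativeRing
                         -Raw-AlmostCommutative⟶ fromCommutativeRing R
  fromℤ-homomorphism = record
    { ⟦_⟧    = fromℤ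
    ; +-homo = fromℤ-+
    ; *-homo = fromℤ-*
    ; -‿homo = fromℤ-neg
    ; 0-homo = refl
    ; 1-homo = refl
    }

  fromℤ-≟ : ∀ i j → Maybe (fromℤ i ≈ fromℤ j)
  fromℤ-≟ i j with i ℤ.≟ j
  ... | yes ≡.refl = just refl
  ... | no  _      = nothing

  open import Algebra.Solver.Ring _ _ fromℤ-homomorphism fromℤ-≟ public

module _ where
  open import Data.Nat using (_+_; _*_)

  [1+k]*[1+n]C[1+k]≡[1+n]*nCk : ∀ n k → suc k * (suc n C suc k) ≡ suc n * (n C k)
  [1+k]*[1+n]C[1+k]≡[1+n]*nCk zero    zero    = ≡.refl
  [1+k]*[1+n]C[1+k]≡[1+n]*nCk zero    (suc k) = ℕ.*-zeroʳ (suc (suc k))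
  [1+k]*[1+n]C[1+k]≡[1+n]*nCk (suc n) zero    =
    ≡.trans (ℕ.*-identityˡ _) (≡.trans (nC1≡n (suc (suc n))) (≡.sym (ℕ.*-identityʳ _)))
  [1+k]*[1+n]C[1+k]≡[1+n]*nCk (suc n) (suc k) = begin
    suc (suc k) * (suc (suc n) C suc (suc k))     ≡⟨ ≡.cong (suc (suc k) *_) (nCk+nC[k+1]≡[n+1]C[k+1] (suc n) (suc k)) ⟨
    suc (suc k) * (A + B)                         ≡⟨ distribute (suc k) A B ⟩
    (suc k * A + A) + suc (suc k) * B
      ≡⟨ ≡.cong₂ (λ a b → (a + A) + b) ([1+k]*[1+n]C[1+k]≡[1+n]*nCk n k) ([1+k]*[1+n]C[1+k]≡[1+n]*nCk n (suc k)) ⟩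
    (suc n * (n C k) + A) + suc n * (n C suc k)   ≡⟨ collect (suc n) (n C k) A (n C suc k) ⟩
    suc n * (n C k + n C suc k) + A               ≡⟨ ≡.cong (λ a → suc n * a + A) (nCk+nC[k+1]≡[n+1]C[k+1] n k) ⟩
    suc n * A + A                                 ≡⟨ ℕ.+-comm (suc n * A) A ⟩
    suc (suc n) * A                               ∎
    where
    open ≡.≡-Reasoning
    A B : ℕ
    A = suc n C suc k
    B = suc n C suc (suc k)
    distribute : ∀ a x y → suc a * (x + y) ≡ (a * x + x) + suc a * y
    distribute = solve-∀
    collect : ∀ a x y z → (a * x + y) + a * z ≡ a * (x + z) + y
    collect = solve-∀

  prime∣pC[1+k] : ∀ {p} → Prime p → ∀ {k} → suc k ℕ.< p → p ∣ p C suc k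
  prime∣pC[1+k] {zero}  p-prime         = contradiction p-prime ¬prime[0]
  prime∣pC[1+k] {suc n} p-prime {k} 1+k<p
    with euclidsLemma (suc k) (suc n C suc k) p-prime
           (divides (n C k) (≡.trans ([1+k]*[1+n]C[1+k]≡[1+n]*nCk n k) (ℕ.*-comm (suc n) (n C k))))
  ... | inj₁ p∣1+k = contradiction p∣1+k (>⇒∤ 1+k<p)
  ... | inj₂ p∣pC[1+k] = p∣pC[1+k]

module Frobenius {c ℓ} (R : CommutativeRing c ℓ) where
  open CommutativeRing R hiding (zero)
  open import Algebra.Properties.Semiring.Mult semiring using (_×_; ×-congʳ; ×-assoc-*; ×1-homo-*)
  open import Algebra.Properties.Semiring.Exp semiring using (_^_; ^-congˡ; ^-assocʳ)
  open import Algebra.Properties.Semiring.Sum semiring using (sum; sum-init-last; sum-cong-≋; sum-replicate-zero)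
  open import Algebra.Properties.CommutativeSemiring.Binomial commutativeSemiring using (theorem; binomialTerm)
  open import Relation.Binary.Reasoning.Setoid setoid

  ×1-homo-^ : ∀ m j → (m ℕ.^ j) × 1# ≈ (m × 1#) ^ j
  ×1-homo-^ m zero    = +-identityʳ 1#
  ×1-homo-^ m (suc j) = trans (×1-homo-* m (m ℕ.^ j)) (*-congˡ (×1-homo-^ m j))

  p∣m⇒m×x≈0 : ∀ {p} → p × 1# ≈ 0# → ∀ {m} x → p ∣ m → m × x ≈ 0#
  p∣m⇒m×x≈0 {p} char {m} x (divides d m≡d*p) = begin
    m × x                     ≈⟨ trans (×-assoc-* m 1# x) (×-congʳ m (*-identityˡ x)) ⟨
    (m × 1#) * x              ≡⟨ ≡.cong (λ k → (k × 1#) * x) m≡d*p ⟩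
    ((d ℕ.* p) × 1#) * x      ≈⟨ *-congʳ (×1-homo-* d p) ⟩
    ((d × 1#) * (p × 1#)) * x ≈⟨ *-congʳ (*-congˡ char) ⟩
    ((d × 1#) * 0#) * x       ≈⟨ trans (*-congʳ (zeroʳ _)) (zeroˡ x) ⟩
    0#                        ∎

  freshmansDream : ∀ {p} → Prime p → p × 1# ≈ 0# → ∀ x y → (x + y) ^ p ≈ x ^ p + y ^ p
  freshmansDream {zero}  p-prime = contradiction p-prime ¬prime[0]
  freshmansDream {suc m} p-prime char x y = begin
    (x + y) ^ p                                            ≈⟨ theorem p x y ⟩
    t zero + sum (t ∘ suc)                                 ≈⟨ +-congˡ (sum-init-last (t ∘ suc)) ⟩
    t zero + (sum (t ∘ suc ∘ inject₁) + t (suc (Fin.fromℕ m)))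
      ≈⟨ +-congˡ (+-congʳ (trans (sum-cong-≋ middle) (sum-replicate-zero m))) ⟩
    t zero + (0# + t (suc (Fin.fromℕ m)))
      ≈⟨ +-cong first (trans (+-identityˡ _) (last (Fin.toℕ-fromℕ m))) ⟩
    y ^ p + x ^ p                                          ≈⟨ +-comm _ _ ⟩
    x ^ p + y ^ p                                          ∎
    where
    p : ℕ
    p = suc m
    t : Fin (suc p) → Carrier
    t = binomialTerm x y p
    first : t zero ≈ y ^ p
    first = trans (+-identityʳ _) (*-identityˡ _)
    last : ∀ {j : Fin p} → toℕ j ≡ m → t (suc j) ≈ x ^ p
    last eq rewrite eq | nCn≡1 p | ℕ.n∸n≡0 p = trans (+-identityʳ _) (*-identityʳ _)
    middle : ∀ i → t (suc (inject₁ i)) ≈ 0#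
    middle i = p∣m⇒m×x≈0 char _
      (≡.subst (λ k → p ∣ p C suc k) (≡.sym (Fin.toℕ-inject₁ i)) (prime∣pC[1+k] p-prime (ℕ.s≤s (Fin.toℕ<n i))))

  freshmansDream-^ : ∀ {p} → Prime p → p × 1# ≈ 0# →
                     ∀ j x y → (x + y) ^ (p ℕ.^ j) ≈ x ^ (p ℕ.^ j) + y ^ (p ℕ.^ j)
  freshmansDream-^ p-prime char zero    x y = trans (*-identityʳ _) (sym (+-cong (*-identityʳ x) (*-identityʳ y)))
  freshmansDream-^ {p} p-prime char (suc j) x y = begin
    (x + y) ^ (p ℕ.* p ℕ.^ j)                 ≈⟨ ^-assocʳ (x + y) p (p ℕ.^ j) ⟨
    ((x + y) ^ p) ^ (p ℕ.^ j)                 ≈⟨ ^-congˡ (p ℕ.^ j) (freshmansDream p-prime char x y) ⟩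
    (x ^ p + y ^ p) ^ (p ℕ.^ j)               ≈⟨ freshmansDream-^ p-prime char j (x ^ p) (y ^ p) ⟩
    (x ^ p) ^ (p ℕ.^ j) + (y ^ p) ^ (p ℕ.^ j) ≈⟨ +-cong (^-assocʳ x p (p ℕ.^ j)) (^-assocʳ y p (p ℕ.^ j)) ⟩
    x ^ (p ℕ.* p ℕ.^ j) + y ^ (p ℕ.* p ℕ.^ j) ∎

Fin-injective⇒surjective : ∀ {n} {g : Fin n → Fin n} → Injective _≡_ _≡_ g → ∀ j → ∃ λ i → g i ≡ j
Fin-injective⇒surjective {suc m} {g} g-inj j with Fin.any? (λ i → g i Fin.≟ j)
... | yes found = found
... | no ¬found = contradiction (Fin.injective⇒≤ h-inj) ℕ.1+n≰n
  where
  j≢g : ∀ i → j ≢ g i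
  j≢g i j≡gi = ¬found (i , ≡.sym j≡gi)
  h : Fin (suc m) → Fin m
  h i = punchOut (j≢g i)
  h-inj : Injective _≡_ _≡_ h
  h-inj {a} {b} = g-inj ∘ Fin.punchOut-injective (j≢g a) (j≢g b)

Fin-injective⇒permutation : ∀ {n} {g : Fin n → Fin n} → Injective _≡_ _≡_ g → Permutation n n
Fin-injective⇒permutation {g = g} g-inj = permutation g
  (proj₁ ∘ Fin-injective⇒surjective g-inj)
  (proj₂ ∘ Fin-injective⇒surjective g-inj)
  (λ i → g-inj (proj₂ (Fin-injective⇒surjective g-inj (g i))))

module _ {a ℓ} (M : CommutativeMonoid a ℓ) where
  open CommutativeMonoid M renaming (_∙_ to _+_)
  open import Algebra.Properties.CommutativeMonoid.Sum M using (sum; sum-remove; sum-cong-≋)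
  open import Algebra.Properties.CommutativeSemigroup commutativeSemigroup using (x∙yz≈y∙xz)
  open import Relation.Binary.Reasoning.Setoid setoid

  sum-agreeingExcept : ∀ {m} (t s : Vector Carrier m) i → (∀ j → j ≢ i → t j ≈ s j) →
                       s i + sum t ≈ t i + sum s
  sum-agreeingExcept {suc m} t s i t≈s = begin
    s i + sum t                                  ≈⟨ ∙-congˡ (sum-remove t) ⟩
    s i + (t i + sum (removeAt t i))             ≈⟨ x∙yz≈y∙xz (s i) (t i) _ ⟩
    t i + (s i + sum (removeAt t i))             ≈⟨ ∙-congˡ (∙-congˡ (sum-cong-≋ (λ j → t≈s _ (Fin.punchInᵢ≢i i j)))) ⟩
    t i + (s i + sum (removeAt s i))             ≈⟨ ∙-congˡ (sum-remove s) ⟨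
    t i + sum s                                  ∎

module FiniteFieldProperties {c ℓ n} (F : FiniteField c ℓ n) where
  open FiniteField F hiding (zero)
  open import Algebra.Properties.Ring ring using (+-cancelˡ; +-cancelʳ; x∙y⁻¹≈ε⇒x≈y)
  open import Algebra.Properties.Semiring.Mult semiring using (_×_)
  open import Algebra.Properties.Semiring.Exp semiring using (_^_; ^-congˡ)
  module ∑ = Algebra.Properties.CommutativeMonoid.Sum +-commutativeMonoid
  module ∏ = Algebra.Properties.CommutativeMonoid.Sum *-commutativeMonoid
  open IntegerCoefficients commRing using (solve; _:=_; _:+_; _:*_; _:-_; con)
  open import Relation.Binary.Reasoning.Setoid setoid

  ^ᶠ≡^ : ∀ x k → x ^ᶠ k ≡ x ^ k
  ^ᶠ≡^ x zero    = ≡.refl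
  ^ᶠ≡^ x (suc k) = ≡.cong (x *_) (^ᶠ≡^ x k)

  index : Carrier → Fin n
  index x = proj₁ (enum-surj x)

  enum-index : ∀ x → enum (index x) ≈ x
  enum-index x = proj₂ (enum-surj x)

  enum-injective : Injective _≡_ _≈_ enum
  enum-injective = enum-inj _ _

  index-injective : Injective _≈_ _≡_ index
  index-injective {x} {y} eq = trans (sym (enum-index x)) (trans (reflexive (≡.cong enum eq)) (enum-index y))

  _≟_ : Decidable _≈_
  x ≟ y with index x Fin.≟ index y
  ... | yes eq = yes (index-injective eq)
  ... | no neq = no (λ x≈y → neq (enum-injective (trans (enum-index x) (trans x≈y (sym (enum-index y))))))

  module _ {g : Carrier → Carrier} (g-inj : Injective _≈_ _≈_ g) where

    reindex : Fin n → Fin n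
    reindex = index ∘ g ∘ enum

    enum-reindex : ∀ i → enum (reindex i) ≈ g (enum i)
    enum-reindex i = enum-index (g (enum i))

    reindex-injective : Injective _≡_ _≡_ reindex
    reindex-injective = enum-injective ∘ g-inj ∘ index-injective

    injective⇒surjective : ∀ y → ∃ λ x → g x ≈ y
    injective⇒surjective y with i , reindex-i≡ ← Fin-injective⇒surjective reindex-injective (index y) =
      enum i , (begin
        g (enum i)          ≈⟨ enum-reindex i ⟨
        enum (reindex i)    ≡⟨ ≡.cong enum reindex-i≡ ⟩
        enum (index y)      ≈⟨ enum-index y ⟩
        y                   ∎)

    module _ {a ℓ′} (M : CommutativeMonoid a ℓ′) where
      private module M = CommutativeMonoid M
      open Algebra.Properties.CommutativeMonoid.Sum M using (sum; sum-permute; sum-cong-≋)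

      sum-reindex : (h : Carrier → M.Carrier) → h Preserves _≈_ ⟶ M._≈_ →
                    sum (h ∘ g ∘ enum) M.≈ sum (h ∘ enum)
      sum-reindex h h-cong = M.sym (M.trans
        (sum-permute (h ∘ enum) (Fin-injective⇒permutation reindex-injective))
        (sum-cong-≋ (h-cong ∘ enum-reindex)))

  ⁻¹-cancelˡ : ∀ {x} → ¬ x ≈ 0# → ∀ y → x ⁻¹ * (x * y) ≈ y
  ⁻¹-cancelˡ {x} x≉0 y = begin
    x ⁻¹ * (x * y)  ≈⟨ *-assoc _ _ _ ⟨
    (x ⁻¹ * x) * y  ≈⟨ *-congʳ (trans (*-comm _ _) (⁻¹-inverse x x≉0)) ⟩
    1# * y          ≈⟨ *-identityˡ y ⟩
    y               ∎

  *-cancelˡ : ∀ {x y z} → ¬ x ≈ 0# → x * y ≈ x * z → y ≈ z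
  *-cancelˡ {x} {y} {z} x≉0 xy≈xz = trans (sym (⁻¹-cancelˡ x≉0 y)) (trans (*-congˡ xy≈xz) (⁻¹-cancelˡ x≉0 z))

  x*y≈0⇒x≈0⊎y≈0 : ∀ {x y} → x * y ≈ 0# → x ≈ 0# ⊎ y ≈ 0#
  x*y≈0⇒x≈0⊎y≈0 {x} {y} xy≈0 with x ≟ 0#
  ... | yes x≈0 = inj₁ x≈0
  ... | no  x≉0 = inj₂ (*-cancelˡ x≉0 (trans xy≈0 (sym (zeroʳ x))))

  *-nonzero : ∀ {x y} → ¬ x ≈ 0# → ¬ y ≈ 0# → ¬ x * y ≈ 0#
  *-nonzero x≉0 y≉0 xy≈0 with x*y≈0⇒x≈0⊎y≈0 xy≈0
  ... | inj₁ x≈0 = x≉0 x≈0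
  ... | inj₂ y≈0 = y≉0 y≈0

  x^k≈0⇒x≈0 : ∀ {x} k → x ^ k ≈ 0# → x ≈ 0#
  x^k≈0⇒x≈0 zero    1≈0 = contradiction 1≈0 1≉0
  x^k≈0⇒x≈0 (suc k) x^[1+k]≈0 with x*y≈0⇒x≈0⊎y≈0 x^[1+k]≈0
  ... | inj₁ x≈0   = x≈0
  ... | inj₂ x^k≈0 = x^k≈0⇒x≈0 k x^k≈0

  ∏-nonzero : ∀ {m} (t : Vector Carrier m) → (∀ i → ¬ t i ≈ 0#) → ¬ ∏.sum t ≈ 0#
  ∏-nonzero {zero}  t t≉0 = 1≉0
  ∏-nonzero {suc m} t t≉0 = *-nonzero (t≉0 zero) (∏-nonzero (t ∘ suc) (t≉0 ∘ suc))

  n×x≈0 : ∀ x → n × x ≈ 0#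
  n×x≈0 x = +-cancelʳ S (n × x) 0# (begin
    n × x + S                ≈⟨ +-congʳ (∑.sum-replicate n) ⟨
    ∑.sum {n} (λ _ → x) + S  ≈⟨ ∑.∑-distrib-+ (λ _ → x) enum ⟨
    ∑.sum ((x +_) ∘ enum)    ≈⟨ sum-reindex (+-cancelˡ x _ _) +-commutativeMonoid (λ y → y) (λ y≈z → y≈z) ⟩
    S                        ≈⟨ +-identityˡ S ⟨
    0# + S                   ∎)
    where
    S : Carrier
    S = ∑.sum enum

  replaceZero : Carrier → Carrier → Carrier
  replaceZero y z with z ≟ 0#
  ... | yes _ = y
  ... | no  _ = z

  replaceZero-≈0 : ∀ y {z} → z ≈ 0# → replaceZero y z ≈ y
  replaceZero-≈0 y {z} z≈0 with z ≟ 0#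
  ... | yes _   = refl
  ... | no  z≉0 = contradiction z≈0 z≉0

  replaceZero-≉0 : ∀ y {z} → ¬ z ≈ 0# → replaceZero y z ≈ z
  replaceZero-≉0 y {z} z≉0 with z ≟ 0#
  ... | yes z≈0 = contradiction z≈0 z≉0
  ... | no  _   = refl

  replaceZero-cong : ∀ y {z z′} → z ≈ z′ → replaceZero y z ≈ replaceZero y z′
  replaceZero-cong y {z} {z′} z≈z′ with z′ ≟ 0#
  ... | yes z′≈0 = replaceZero-≈0 y (trans z≈z′ z′≈0)
  ... | no  z′≉0 = trans (replaceZero-≉0 y (z′≉0 ∘ trans (sym z≈z′))) z≈z′

  replaceZero-nonzero : ∀ {y} z → ¬ y ≈ 0# → ¬ replaceZero y z ≈ 0#
  replaceZero-nonzero z y≉0 with z ≟ 0#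
  ... | yes _   = y≉0
  ... | no  z≉0 = z≉0

  replaceZero-* : ∀ {x} → ¬ x ≈ 0# → ∀ z → replaceZero x (x * z) ≈ x * replaceZero 1# z
  replaceZero-* {x} x≉0 z with z ≟ 0#
  ... | yes z≈0 = trans (replaceZero-≈0 x (trans (*-congˡ z≈0) (zeroʳ x))) (sym (*-identityʳ x))
  ... | no  z≉0 = replaceZero-≉0 x (*-nonzero x≉0 z≉0)

  ∏-replaceZero : ∀ x → ∏.sum (replaceZero x ∘ enum) ≈ x * ∏.sum (replaceZero 1# ∘ enum)
  ∏-replaceZero x = begin
    Pₓ                              ≈⟨ *-identityˡ Pₓ ⟨
    1# * Pₓ                         ≈⟨ *-congʳ (replaceZero-≈0 1# (enum-index 0#)) ⟨
    replaceZero 1# (enum i₀) * Pₓ   ≈⟨ sum-agreeingExcept *-commutativeMonoid _ _ i₀ agree ⟩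
    replaceZero x (enum i₀) * P₁    ≈⟨ *-congʳ (replaceZero-≈0 x (enum-index 0#)) ⟩
    x * P₁                          ∎
    where
    i₀ : Fin n
    i₀ = index 0#
    Pₓ P₁ : Carrier
    Pₓ = ∏.sum (replaceZero x ∘ enum)
    P₁ = ∏.sum (replaceZero 1# ∘ enum)
    agree : ∀ j → j ≢ index 0# → replaceZero x (enum j) ≈ replaceZero 1# (enum j)
    agree j j≢i₀ = trans (replaceZero-≉0 x enumj≉0) (sym (replaceZero-≉0 1# enumj≉0))
      where
      enumj≉0 : ¬ enum j ≈ 0#
      enumj≉0 enumj≈0 = j≢i₀ (enum-injective (trans enumj≈0 (sym (enum-index 0#))))

  0^m≈0 : ∀ {m} → Fin m → 0# ^ m ≈ 0#
  0^m≈0 {suc m} _ = zeroˡ _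

  -- Multiplication by x ≠ 0 permutes the field, so ∏_z replaceZero x (x z) = ∏_z replaceZero x z;
  -- the two sides are xⁿ P and x P for the nonzero product P = ∏_z replaceZero 1# z.
  x^n≈x : ∀ x → x ^ n ≈ x
  x^n≈x x with x ≟ 0#
  ... | yes x≈0 = trans (^-congˡ n x≈0) (trans (0^m≈0 (index 0#)) (sym x≈0))
  ... | no  x≉0 = *-cancelˡ (∏-nonzero _ (λ i → replaceZero-nonzero (enum i) 1≉0)) (begin
    P * x ^ n                              ≈⟨ *-comm _ _ ⟩
    x ^ n * P                              ≈⟨ *-congʳ (∏.sum-replicate n) ⟨
    ∏.sum {n} (λ _ → x) * P                ≈⟨ ∏.∑-distrib-+ (λ _ → x) (replaceZero 1# ∘ enum) ⟨
    ∏.sum (λ i → x * replaceZero 1# (enum i)) ≈⟨ ∏.sum-cong-≋ (replaceZero-* x≉0 ∘ enum) ⟨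
    ∏.sum (replaceZero x ∘ (x *_) ∘ enum)
      ≈⟨ sum-reindex (*-cancelˡ x≉0) *-commutativeMonoid (replaceZero x) (replaceZero-cong x) ⟩
    ∏.sum (replaceZero x ∘ enum)           ≈⟨ ∏-replaceZero x ⟩
    x * P                                  ≈⟨ *-comm _ _ ⟩
    P * x                                  ∎)
    where
    P : Carrier
    P = ∏.sum (replaceZero 1# ∘ enum)

  1+1≉0 : ∀ {N} → ¬ 2 ∣ N → N × 1# ≈ 0# → ¬ 1# + 1# ≈ 0#
  1+1≉0 {N} N-odd N×1≈0 1+1≈0 = odd×1≉0 N N-odd N×1≈0
    where
    [2+m]×1≈m×1 : ∀ m → suc (suc m) × 1# ≈ m × 1#
    [2+m]×1≈m×1 m = trans (sym (+-assoc 1# 1# _)) (trans (+-congʳ 1+1≈0) (+-identityˡ _))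
    odd×1≉0 : ∀ m → ¬ 2 ∣ m → ¬ m × 1# ≈ 0#
    odd×1≉0 zero          m-odd _      = m-odd (divides 0 ≡.refl)
    odd×1≉0 (suc zero)    _     1+0≈0  = 1≉0 (trans (sym (+-identityʳ 1#)) 1+0≈0)
    odd×1≉0 (suc (suc m)) m-odd m×1≈0 =
      odd×1≉0 m (m-odd ∘ ∣m∣n⇒∣m+n (∣-refl {2})) (trans (sym ([2+m]×1≈m×1 m)) m×1≈0)

  -- evalMonic (c₀ ∷ … ∷ c_{d-1}) x = c₀ + c₁ x + … + c_{d-1} x^{d-1} + x^d
  evalMonic : List Carrier → Carrier → Carrier
  evalMonic []       x = 1#
  evalMonic (c ∷ cs) x = c + x * evalMonic cs x

  quotientByRoot : Carrier → List Carrier → List Carrier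
  quotientByRoot a []           = []
  quotientByRoot a (c ∷ [])     = []
  quotientByRoot a (c ∷ d ∷ ds) = evalMonic (d ∷ ds) a ∷ quotientByRoot a (d ∷ ds)

  length-quotientByRoot : ∀ a c cs → length (quotientByRoot a (c ∷ cs)) ≡ length cs
  length-quotientByRoot a c []       = ≡.refl
  length-quotientByRoot a c (d ∷ ds) = ≡.cong suc (length-quotientByRoot a d ds)

  evalMonic-division : ∀ a c cs x →
    evalMonic (c ∷ cs) x ≈ (x - a) * evalMonic (quotientByRoot a (c ∷ cs)) x + evalMonic (c ∷ cs) a
  evalMonic-division a c [] x =
    solve 3 (λ c x a → c :+ x :* con (ℤ.+ 1) := (x :- a) :* con (ℤ.+ 1) :+ (c :+ a :* con (ℤ.+ 1))) refl c x a
  evalMonic-division a c (d ∷ ds) x = begin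
    c + x * Q x                          ≈⟨ +-congˡ (*-congˡ (evalMonic-division a d ds x)) ⟩
    c + x * ((x - a) * G + Q a)          ≈⟨ solve 5 (λ c x a G Qa → c :+ x :* ((x :- a) :* G :+ Qa)
                                              := (x :- a) :* (Qa :+ x :* G) :+ (c :+ a :* Qa)) refl c x a G (Q a) ⟩
    (x - a) * (Q a + x * G) + (c + a * Q a) ∎
    where
    Q : Carrier → Carrier
    Q = evalMonic (d ∷ ds)
    G : Carrier
    G = evalMonic (quotientByRoot a (d ∷ ds)) x

  monic-roots≤degree : ∀ N cs → length cs ≡ N → (r : Fin (suc N) → Carrier) → Injective _≡_ _≈_ r →
                       ¬ (∀ i → evalMonic cs (r i) ≈ 0#)
  monic-roots≤degree N       []       _   r r-inj roots = 1≉0 (roots zero)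
  monic-roots≤degree (suc N) (c ∷ cs) len r r-inj roots =
    monic-roots≤degree N (quotientByRoot a (c ∷ cs)) (≡.trans (length-quotientByRoot a c cs) (ℕ.suc-injective len))
      (r ∘ suc) (Fin.suc-injective ∘ r-inj) quotient-roots
    where
    a : Carrier
    a = r zero
    Q : Carrier → Carrier
    Q = evalMonic (quotientByRoot a (c ∷ cs))
    [rᵢ-a]*Qrᵢ≈0 : ∀ i → (r (suc i) - a) * Q (r (suc i)) ≈ 0#
    [rᵢ-a]*Qrᵢ≈0 i = begin
      (r (suc i) - a) * Q (r (suc i))                          ≈⟨ +-identityʳ _ ⟨
      (r (suc i) - a) * Q (r (suc i)) + 0#                     ≈⟨ +-congˡ (roots zero) ⟨
      (r (suc i) - a) * Q (r (suc i)) + evalMonic (c ∷ cs) a   ≈⟨ evalMonic-division a c cs (r (suc i)) ⟨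
      evalMonic (c ∷ cs) (r (suc i))                           ≈⟨ roots (suc i) ⟩
      0#                                                       ∎
    quotient-roots : ∀ i → Q (r (suc i)) ≈ 0#
    quotient-roots i = [ (λ rᵢ-a≈0 → contradiction (r-inj (x∙y⁻¹≈ε⇒x≈y _ _ rᵢ-a≈0)) λ ()) , id ]′
      (x*y≈0⇒x≈0⊎y≈0 ([rᵢ-a]*Qrᵢ≈0 i))

2≤p^[1+k] : ∀ {p} → Prime p → ∀ k → 2 ≤ p ℕ.^ suc k
2≤p^[1+k] {0}           p-prime = contradiction p-prime ¬prime[0]
2≤p^[1+k] {1}           p-prime = contradiction p-prime ¬prime[1]
2≤p^[1+k] {p@(2+ _)}    _     k = ℕ.≤-trans (ℕ.s≤s (ℕ.s≤s ℕ.z≤n)) (ℕ.m≤m*n p (p ℕ.^ k) {{ℕ.m^n≢0 p k}})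

n<n^2 : ∀ {n} → 2 ≤ n → n ℕ.< n ℕ.^ 2
n<n^2 {n} 2≤n = begin
  suc n           ≤⟨ ℕ.+-monoˡ-≤ n (ℕ.≤-trans (ℕ.n≤1+n 1) 2≤n) ⟩
  n ℕ.+ n         ≡⟨ ≡.cong (n ℕ.+_) (ℕ.+-identityʳ n) ⟨
  2 ℕ.* n         ≤⟨ ℕ.*-monoˡ-≤ n 2≤n ⟩
  n ℕ.* n         ≡⟨ ≡.cong (n ℕ.*_) (ℕ.*-identityʳ n) ⟨
  n ℕ.^ 2         ∎
  where open ℕ.≤-Reasoning

module FrobeniusInvolution {c ℓ} {p k q : ℕ} (p-prime : Prime p) (q≡p^[1+k] : q ≡ p ℕ.^ suc k)
                           (F : FiniteField c ℓ (q ℕ.^ 2)) where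
  open FiniteField F hiding (zero)
  open FiniteFieldProperties F
  open import Algebra.Properties.Ring ring
    using (x+x≈x⇒x≈0; x≈y⇒x∙y⁻¹≈ε; x∙y⁻¹≈ε⇒x≈y; x[y-z]≈xy-xz; +-inverseʳ-unique; -‿involutive;
           -‿distribˡ-*; -‿distribʳ-*)
  open import Algebra.Properties.Semiring.Mult semiring using (_×_)
  open import Algebra.Properties.CommutativeSemiring.Exp commutativeSemiring using (_^_; ^-distrib-*; ^-assocʳ; ^-congˡ; ^-homo-*)
  open Frobenius commRing using (×1-homo-^; freshmansDream-^)
  open IntegerCoefficients commRing using (solve; _:=_; _:+_; _:*_; _:-_; :-_; con)
  open import Relation.Binary.Reasoning.Setoid setoid

  characteristic : p × 1# ≈ 0#
  characteristic = x^k≈0⇒x≈0 (suc k ℕ.* 2) (begin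
    (p × 1#) ^ (suc k ℕ.* 2)     ≈⟨ ×1-homo-^ p (suc k ℕ.* 2) ⟨
    (p ℕ.^ (suc k ℕ.* 2)) × 1#   ≡⟨ ≡.cong (_× 1#) (≡.trans (≡.cong (ℕ._^ 2) q≡p^[1+k]) (ℕ.^-*-assoc p (suc k) 2)) ⟨
    (q ℕ.^ 2) × 1#               ≈⟨ n×x≈0 1# ⟩
    0#                           ∎)

  σ : Carrier → Carrier
  σ x = x ^ᶠ q

  σ≈^q : ∀ x → σ x ≈ x ^ q
  σ≈^q x = reflexive (^ᶠ≡^ x q)

  σ-cong : ∀ {x y} → x ≈ y → σ x ≈ σ y
  σ-cong {x} {y} x≈y = trans (σ≈^q x) (trans (^-congˡ q x≈y) (sym (σ≈^q y)))

  σ-homo-+ : ∀ x y → σ (x + y) ≈ σ x + σ y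
  σ-homo-+ x y = begin
    σ (x + y)                              ≈⟨ σ≈^q (x + y) ⟩
    (x + y) ^ q                            ≡⟨ ≡.cong ((x + y) ^_) q≡p^[1+k] ⟩
    (x + y) ^ (p ℕ.^ suc k)                ≈⟨ freshmansDream-^ p-prime characteristic (suc k) x y ⟩
    x ^ (p ℕ.^ suc k) + y ^ (p ℕ.^ suc k)  ≡⟨ ≡.cong (λ j → x ^ j + y ^ j) q≡p^[1+k] ⟨
    x ^ q + y ^ q                          ≈⟨ +-cong (σ≈^q x) (σ≈^q y) ⟨
    σ x + σ y                              ∎

  σ-homo-* : ∀ x y → σ (x * y) ≈ σ x * σ y
  σ-homo-* x y = trans (σ≈^q (x * y)) (trans (^-distrib-* x y q) (sym (*-cong (σ≈^q x) (σ≈^q y))))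

  σ-1 : σ 1# ≈ 1#
  σ-1 = 1^ᶠk≈1 q
    where
    1^ᶠk≈1 : ∀ k → 1# ^ᶠ k ≈ 1#
    1^ᶠk≈1 zero    = refl
    1^ᶠk≈1 (suc k) = trans (*-identityˡ _) (1^ᶠk≈1 k)

  σ-0 : σ 0# ≈ 0#
  σ-0 = x+x≈x⇒x≈0 (σ 0#) (trans (sym (σ-homo-+ 0# 0#)) (σ-cong (+-identityʳ 0#)))

  σ-neg : ∀ x → σ (- x) ≈ - σ x
  σ-neg x = +-inverseʳ-unique (σ x) (σ (- x))
    (trans (sym (σ-homo-+ x (- x))) (trans (σ-cong (-‿inverseʳ x)) σ-0))

  σ[x-y]≈σx-σy : ∀ x y → σ (x - y) ≈ σ x - σ y
  σ[x-y]≈σx-σy x y = trans (σ-homo-+ x (- y)) (+-congˡ (σ-neg y))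

  σ-involutive : ∀ x → σ (σ x) ≈ x
  σ-involutive x = begin
    σ (σ x)           ≈⟨ trans (σ≈^q (σ x)) (^-congˡ q (σ≈^q x)) ⟩
    (x ^ q) ^ q       ≈⟨ ^-assocʳ x q q ⟩
    x ^ (q ℕ.* q)     ≡⟨ ≡.cong (λ j → x ^ (q ℕ.* j)) (ℕ.*-identityʳ q) ⟨
    x ^ (q ℕ.^ 2)     ≈⟨ x^n≈x x ⟩
    x                 ∎

  x^ᶠ[2q]≈σx*σx : ∀ x → x ^ᶠ (2 ℕ.* q) ≈ σ x * σ x
  x^ᶠ[2q]≈σx*σx x = begin
    x ^ᶠ (q ℕ.+ (q ℕ.+ 0))   ≡⟨ ^ᶠ≡^ x (q ℕ.+ (q ℕ.+ 0)) ⟩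
    x ^ (q ℕ.+ (q ℕ.+ 0))    ≈⟨ ^-homo-* x q (q ℕ.+ 0) ⟩
    x ^ q * x ^ (q ℕ.+ 0)    ≡⟨ ≡.cong (λ j → x ^ q * x ^ j) (ℕ.+-identityʳ q) ⟩
    x ^ q * x ^ q            ≈⟨ *-cong (σ≈^q x) (σ≈^q x) ⟨
    σ x * σ x                ∎

  σ-1+1 : σ (1# + 1#) ≈ 1# + 1#
  σ-1+1 = trans (σ-homo-+ 1# 1#) (+-cong σ-1 σ-1)

  σ-⁻¹-antifixed : ∀ {a} → ¬ a ≈ 0# → σ a ≈ - a → σ (a ⁻¹) ≈ - (a ⁻¹)
  σ-⁻¹-antifixed {a} a≉0 σa≈-a = *-cancelˡ a≉0 (begin
    a * σ (a ⁻¹)        ≈⟨ -‿involutive _ ⟨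
    - - (a * σ (a ⁻¹))  ≈⟨ -‿cong (trans (-‿distribˡ-* a _) (*-congʳ (sym σa≈-a))) ⟩
    - (σ a * σ (a ⁻¹))  ≈⟨ -‿cong (trans (sym (σ-homo-* a (a ⁻¹))) (trans (σ-cong (⁻¹-inverse a a≉0)) σ-1)) ⟩
    - 1#                ≈⟨ -‿cong (⁻¹-inverse a a≉0) ⟨
    - (a * a ⁻¹)        ≈⟨ -‿distribʳ-* a _ ⟩
    a * - (a ⁻¹)        ∎)

  2≤q : 2 ≤ q
  2≤q = ≡.subst (2 ≤_) (≡.sym q≡p^[1+k]) (2≤p^[1+k] p-prime k)

  xᵠ-x : List Carrier
  xᵠ-x = 0# ∷ - 1# ∷ replicate (q ℕ.∸ 2) 0#

  length-xᵠ-x : length xᵠ-x ≡ q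
  length-xᵠ-x = ≡.trans (≡.cong (2 ℕ.+_) (List.length-replicate (q ℕ.∸ 2))) (ℕ.m+[n∸m]≡n 2≤q)

  evalMonic-replicate-0 : ∀ j x → evalMonic (replicate j 0#) x ≈ x ^ᶠ j
  evalMonic-replicate-0 zero    x = refl
  evalMonic-replicate-0 (suc j) x = trans (+-identityˡ _) (*-congˡ (evalMonic-replicate-0 j x))

  evalMonic-xᵠ-x : ∀ x → evalMonic xᵠ-x x ≈ σ x - x
  evalMonic-xᵠ-x x = begin
    0# + x * (- 1# + x * evalMonic (replicate (q ℕ.∸ 2) 0#) x)
      ≈⟨ +-congˡ (*-congˡ (+-congˡ (*-congˡ (evalMonic-replicate-0 (q ℕ.∸ 2) x)))) ⟩
    0# + x * (- 1# + x * x ^ᶠ (q ℕ.∸ 2))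
      ≈⟨ solve 2 (λ x y → con (ℤ.+ 0) :+ x :* (:- con (ℤ.+ 1) :+ x :* y) := x :* (x :* y) :- x) refl x (x ^ᶠ (q ℕ.∸ 2)) ⟩
    x ^ᶠ (2 ℕ.+ (q ℕ.∸ 2)) - x
      ≡⟨ ≡.cong (λ j → x ^ᶠ j - x) (ℕ.m+[n∸m]≡n 2≤q) ⟩
    σ x - x ∎

  ∃-nonfixed : ∃ λ z → ¬ σ z ≈ z
  ∃-nonfixed with Fin.any? (λ i → ¬? (σ (enum i) ≟ enum i))
  ... | yes (i , σzᵢ≉zᵢ) = enum i , σzᵢ≉zᵢ
  ... | no  ¬∃           = contradiction roots (monic-roots≤degree q xᵠ-x length-xᵠ-x r r-injective)
    where
    r : Fin (suc q) → Carrier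
    r i = enum (Fin.inject≤ i (n<n^2 2≤q))
    r-injective : ∀ {i j} → r i ≈ r j → i ≡ j
    r-injective = Fin.inject≤-injective (n<n^2 2≤q) (n<n^2 2≤q) _ _ ∘ enum-injective
    roots : ∀ i → evalMonic xᵠ-x (r i) ≈ 0#
    roots i = trans (evalMonic-xᵠ-x (r i))
      (x≈y⇒x∙y⁻¹≈ε (decidable-stable (σ (r i) ≟ r i) (λ σrᵢ≉rᵢ → ¬∃ (_ , σrᵢ≉rᵢ))))

  σ-Tr : ∀ x → σ (Tr q x) ≈ Tr q x
  σ-Tr x = trans (σ-homo-+ x (σ x)) (trans (+-congˡ (σ-involutive x)) (+-comm _ _))

  u : Carrier → Carrier
  u x = σ x - x

  σ-u : ∀ x → σ (u x) ≈ - u x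
  σ-u x = trans (σ[x-y]≈σx-σy (σ x) x)
    (trans (+-congʳ (σ-involutive x)) (solve 2 (λ x y → x :- y := :- (y :- x)) refl x (σ x)))

  u-homo-+ : ∀ x y → u (x + y) ≈ u x + u y
  u-homo-+ x y = trans (+-congʳ (σ-homo-+ x y))
    (solve 4 (λ a b x y → (a :+ b) :- (x :+ y) := (a :- x) :+ (b :- y)) refl (σ x) (σ y) x y)

  u-fixed-* : ∀ {a} → σ a ≈ a → ∀ x → u (a * x) ≈ a * u x
  u-fixed-* {a} σa≈a x = trans (+-congʳ (trans (σ-homo-* a x) (*-congʳ σa≈a))) (sym (x[y-z]≈xy-xz a (σ x) x))

  antifixed⇒∈image-u : ∀ {w a} → ¬ σ w ≈ w → σ a ≈ - a → ∃ λ x → u x ≈ a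
  antifixed⇒∈image-u {w} {a} σw≉w σa≈-a = a * u w ⁻¹ * w , (begin
    u (a * u w ⁻¹ * w)      ≈⟨ u-fixed-* σc≈c w ⟩
    a * u w ⁻¹ * u w        ≈⟨ *-assoc a _ _ ⟩
    a * (u w ⁻¹ * u w)      ≈⟨ *-congˡ (trans (*-comm _ _) (⁻¹-inverse (u w) uw≉0)) ⟩
    a * 1#                  ≈⟨ *-identityʳ a ⟩
    a                       ∎)
    where
    uw≉0 : ¬ u w ≈ 0#
    uw≉0 = σw≉w ∘ x∙y⁻¹≈ε⇒x≈y _ _
    σc≈c : σ (a * u w ⁻¹) ≈ a * u w ⁻¹
    σc≈c = begin
      σ (a * u w ⁻¹)          ≈⟨ σ-homo-* a _ ⟩
      σ a * σ (u w ⁻¹)        ≈⟨ *-cong σa≈-a (σ-⁻¹-antifixed uw≉0 (σ-u w)) ⟩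
      - a * - (u w ⁻¹)        ≈⟨ solve 2 (λ a b → :- a :* :- b := a :* b) refl a (u w ⁻¹) ⟩
      a * u w ⁻¹              ∎

module PermutationCriterion {c ℓ} {p k q : ℕ} (p-prime : Prime p) (q≡p^[1+k] : q ≡ p ℕ.^ suc k)
                            (q-odd : ¬ 2 ∣ q) (F : FiniteField c ℓ (q ℕ.^ 2))
                            (γ δ : FiniteField.Carrier F) where
  open FiniteField F
  open FiniteFieldProperties F
  open FrobeniusInvolution {k = k} p-prime q≡p^[1+k] F
  open import Algebra.Properties.Ring ring
    using (+-cancelˡ; x∙y⁻¹≈ε⇒x≈y; x≈y⇒x∙y⁻¹≈ε; -‿involutive; -‿distribʳ-*)
  open IntegerCoefficients commRing using (solve; _:=_; _:+_; _:*_; _:-_; :-_; con)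
  open import Relation.Binary.Reasoning.Setoid setoid

  f : Carrier → Carrier
  f x = ((((x ^ᶠ q) - x) + δ) ^ᶠ (2 ℕ.* q)) + (γ * x)

  2# : Carrier
  2# = 1# + 1#

  β : Carrier
  β = (Tr q δ + Tr q δ) + γ

  2#≉0 : ¬ 2# ≈ 0#
  2#≉0 = 1+1≉0 p-odd characteristic
    where
    p-odd : ¬ 2 ∣ p
    p-odd 2∣p = q-odd (≡.subst (2 ∣_) (≡.sym q≡p^[1+k]) (∣-trans 2∣p (m∣m*n (p ℕ.^ k))))

  4#≈2#*2# : 4# ≈ 2# * 2#
  4#≈2#*2# = solve 0 (con (ℤ.+ 1) :+ (con (ℤ.+ 1) :+ (con (ℤ.+ 1) :+ con (ℤ.+ 1))) := con (ℤ.+ 2) :* con (ℤ.+ 2)) refl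

  2#*[2#*4⁻¹]≈1 : 2# * (2# * 4# ⁻¹) ≈ 1#
  2#*[2#*4⁻¹]≈1 = trans (sym (*-assoc _ _ _)) (trans (*-congʳ (sym 4#≈2#*2#)) (⁻¹-inverse 4# 4#≉0))
    where
    4#≉0 : ¬ 4# ≈ 0#
    4#≉0 4#≈0 = *-nonzero 2#≉0 2#≉0 (trans (sym 4#≈2#*2#) 4#≈0)

  f-via-u : ∀ x → f x ≈ (σ δ - u x) * (σ δ - u x) + γ * x
  f-via-u x = +-congʳ (trans (x^ᶠ[2q]≈σx*σx (u x + δ)) (*-cong σ[ux+δ] σ[ux+δ]))
    where
    σ[ux+δ] : σ (u x + δ) ≈ σ δ - u x
    σ[ux+δ] = trans (σ-homo-+ (u x) δ) (trans (+-congʳ (σ-u x)) (+-comm _ _))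

  f-translate : ∀ x w → f (x + w) ≈ f x + ((u w * u w + γ * w) - (2# * u w) * (σ δ - u x))
  f-translate x w = begin
    f (x + w)                                              ≈⟨ f-via-u (x + w) ⟩
    (σ δ - u (x + w)) * (σ δ - u (x + w)) + γ * (x + w)
      ≈⟨ +-congʳ (*-cong (+-congˡ (-‿cong (u-homo-+ x w))) (+-congˡ (-‿cong (u-homo-+ x w)))) ⟩
    (σ δ - (u x + u w)) * (σ δ - (u x + u w)) + γ * (x + w)
      ≈⟨ solve 6 (λ e a b g x w → (e :- (a :+ b)) :* (e :- (a :+ b)) :+ g :* (x :+ w)
                   := ((e :- a) :* (e :- a) :+ g :* x) :+ ((b :* b :+ g :* w) :- (con (ℤ.+ 2) :* b) :* (e :- a)))
                 refl (σ δ) (u x) (u w) γ x w ⟩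
    ((σ δ - u x) * (σ δ - u x) + γ * x) + ((u w * u w + γ * w) - (2# * u w) * (σ δ - u x))
                                                           ≈⟨ +-congʳ (f-via-u x) ⟨
    f x + ((u w * u w + γ * w) - (2# * u w) * (σ δ - u x)) ∎

  σ-β : σ β ≈ (Tr q δ + Tr q δ) + σ γ
  σ-β = trans (σ-homo-+ _ γ) (+-congʳ (trans (σ-homo-+ _ _) (+-cong (σ-Tr δ) (σ-Tr δ))))

  σf-f : σ γ ≈ γ → ∀ x → σ (f x) - f x ≈ (δ * δ - σ δ * σ δ) + u x * β
  σf-f σγ≈γ x = begin
    σ (f x) - f x
      ≈⟨ +-cong (σ-cong (f-via-u x)) (-‿cong (f-via-u x)) ⟩
    σ ((σ δ - u x) * (σ δ - u x) + γ * x) - ((σ δ - u x) * (σ δ - u x) + γ * x)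
      ≈⟨ +-congʳ σ-expand ⟩
    ((δ + u x) * (δ + u x) + γ * σ x) - ((σ δ - u x) * (σ δ - u x) + γ * x)
      ≈⟨ solve 5 (λ d e s x g → ((d :+ (s :- x)) :* (d :+ (s :- x)) :+ g :* s) :- ((e :- (s :- x)) :* (e :- (s :- x)) :+ g :* x)
                   := (d :* d :- e :* e) :+ (s :- x) :* (((d :+ e) :+ (d :+ e)) :+ g))
                 refl δ (σ δ) (σ x) x γ ⟩
    (δ * δ - σ δ * σ δ) + u x * β
      ∎
    where
    σ[σδ-ux] : σ (σ δ - u x) ≈ δ + u x
    σ[σδ-ux] = trans (σ[x-y]≈σx-σy (σ δ) (u x)) (+-cong (σ-involutive δ) (trans (-‿cong (σ-u x)) (-‿involutive _)))
    σ-expand : σ ((σ δ - u x) * (σ δ - u x) + γ * x) ≈ (δ + u x) * (δ + u x) + γ * σ x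
    σ-expand = trans (σ-homo-+ _ _)
      (+-cong (trans (σ-homo-* _ _) (*-cong σ[σδ-ux] σ[σδ-ux])) (trans (σ-homo-* γ x) (*-congʳ σγ≈γ)))

  module Collision {w} (σw≉w : ¬ σ w ≈ w) (σβw≈βw : σ (β * w) ≈ β * w) where

    v D ι N t : Carrier
    v = u w
    D = 2# * v
    ι = D ⁻¹
    N = v * v + γ * w
    t = σ δ - N * ι

    D≉0 : ¬ D ≈ 0#
    D≉0 = *-nonzero 2#≉0 (σw≉w ∘ x∙y⁻¹≈ε⇒x≈y _ _)

    1-Dι≈0 : 1# - D * ι ≈ 0#
    1-Dι≈0 = x≈y⇒x∙y⁻¹≈ε (sym (⁻¹-inverse D D≉0))

    σι : σ ι ≈ - ι
    σι = σ-⁻¹-antifixed D≉0 (trans (σ-homo-* 2# v) (trans (*-cong σ-1+1 (σ-u w)) (sym (-‿distribʳ-* 2# v))))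

    σN : σ N ≈ v * v + (β * w - (Tr q δ + Tr q δ) * σ w)
    σN = trans (σ-homo-+ _ _) (+-cong σ[vv] σ[γw])
      where
      tt : Carrier
      tt = Tr q δ + Tr q δ
      σ[vv] : σ (v * v) ≈ v * v
      σ[vv] = trans (σ-homo-* v v) (trans (*-cong (σ-u w) (σ-u w)) (solve 1 (λ v → :- v :* :- v := v :* v) refl v))
      σ[γw] : σ (γ * w) ≈ β * w - tt * σ w
      σ[γw] = begin
        σ (γ * w)                    ≈⟨ σ-homo-* γ w ⟩
        σ γ * σ w                    ≈⟨ solve 3 (λ t g s → g :* s := (t :+ g) :* s :- t :* s) refl tt (σ γ) (σ w) ⟩
        (tt + σ γ) * σ w - tt * σ w  ≈⟨ +-congʳ (trans (*-congʳ (sym σ-β)) (trans (sym (σ-homo-* β w)) σβw≈βw)) ⟩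
        β * w - tt * σ w             ∎

    σt≈-t : σ t ≈ - t
    σt≈-t = begin
      σ t                                                          ≈⟨ σ[x-y]≈σx-σy (σ δ) (N * ι) ⟩
      σ (σ δ) - σ (N * ι)
        ≈⟨ +-cong (σ-involutive δ) (-‿cong (trans (σ-homo-* N ι) (*-cong σN σι))) ⟩
      δ - (v * v + (β * w - (Tr q δ + Tr q δ) * σ w)) * - ι
        ≈⟨ solve 6 (λ d e s w g i →
             let T = d :+ e ; v = s :- w in
             d :- (v :* v :+ (((T :+ T) :+ g) :* w :- (T :+ T) :* s)) :* (:- i)
               := :- (e :- (v :* v :+ g :* w) :* i) :+ T :* (con (ℤ.+ 1) :- (con (ℤ.+ 2) :* v) :* i))
           refl δ (σ δ) (σ w) w γ ι ⟩
      - t + Tr q δ * (1# - D * ι)                                  ≈⟨ +-congˡ (trans (*-congˡ 1-Dι≈0) (zeroʳ _)) ⟩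
      - t + 0#                                                     ≈⟨ +-identityʳ _ ⟩
      - t                                                          ∎

    -- Choosing u x = t makes f (x + w) - f x = N - D (σ δ - u x) vanish.
    collision : ∃ λ x → f (x + w) ≈ f x
    collision = x , (begin
      f (x + w)                    ≈⟨ f-translate x w ⟩
      f x + (N - D * (σ δ - u x))  ≈⟨ +-congˡ (+-congˡ (-‿cong (*-congˡ (+-congˡ (-‿cong ux≈t))))) ⟩
      f x + (N - D * (σ δ - t))
        ≈⟨ +-congˡ (solve 4 (λ n d e i → n :- d :* (e :- (e :- n :* i)) := n :* (con (ℤ.+ 1) :- d :* i)) refl N D (σ δ) ι) ⟩
      f x + N * (1# - D * ι)       ≈⟨ +-congˡ (trans (*-congˡ 1-Dι≈0) (zeroʳ N)) ⟩
      f x + 0#                     ≈⟨ +-identityʳ (f x) ⟩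
      f x                          ∎)
      where
      x : Carrier
      x = proj₁ (antifixed⇒∈image-u σw≉w σt≈-t)
      ux≈t : u x ≈ t
      ux≈t = proj₂ (antifixed⇒∈image-u σw≉w σt≈-t)

  collision⇒¬injective : ∀ {w} → ¬ σ w ≈ w → σ (β * w) ≈ β * w → ¬ Injective _≈_ _≈_ f
  collision⇒¬injective {w} σw≉w σβw≈βw f-inj = σw≉w (trans (σ-cong w≈0) (trans σ-0 (sym w≈0)))
    where
    open Collision σw≉w σβw≈βw using (collision)
    w≈0 : w ≈ 0#
    w≈0 = +-cancelˡ (proj₁ collision) w 0# (trans (f-inj (proj₂ collision)) (sym (+-identityʳ _)))

  injective⇒β≉0 : Injective _≈_ _≈_ f → ¬ β ≈ 0#
  injective⇒β≉0 f-inj β≈0 = collision⇒¬injective (proj₂ ∃-nonfixed) σβz≈βz f-inj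
    where
    z : Carrier
    z = proj₁ ∃-nonfixed
    βz≈0 : β * z ≈ 0#
    βz≈0 = trans (*-congʳ β≈0) (zeroˡ z)
    σβz≈βz : σ (β * z) ≈ β * z
    σβz≈βz = trans (σ-cong βz≈0) (trans σ-0 (sym βz≈0))

  -- If σ γ ≠ γ then σ β ≠ β, so w = β⁻¹ is not fixed while β w = 1 is.
  injective⇒σγ≈γ : Injective _≈_ _≈_ f → σ γ ≈ γ
  injective⇒σγ≈γ f-inj = decidable-stable (σ γ ≟ γ) (λ σγ≉γ →
    collision⇒¬injective (σβ⁻¹≉β⁻¹ σγ≉γ) (trans σ[ββ⁻¹]≈1 (sym ββ⁻¹≈1)) f-inj)
    where
    β≉0 : ¬ β ≈ 0#
    β≉0 = injective⇒β≉0 f-inj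
    ββ⁻¹≈1 : β * β ⁻¹ ≈ 1#
    ββ⁻¹≈1 = ⁻¹-inverse β β≉0
    σ[ββ⁻¹]≈1 : σ (β * β ⁻¹) ≈ 1#
    σ[ββ⁻¹]≈1 = trans (σ-cong ββ⁻¹≈1) σ-1
    σβ⁻¹≉β⁻¹ : ¬ σ γ ≈ γ → ¬ σ (β ⁻¹) ≈ β ⁻¹
    σβ⁻¹≉β⁻¹ σγ≉γ σβ⁻¹≈β⁻¹ = σγ≉γ (+-cancelˡ (Tr q δ + Tr q δ) (σ γ) γ (trans (sym σ-β) σβ≈β))
      where
      σβ≈β : σ β ≈ β
      σβ≈β = begin
        σ β                     ≈⟨ *-identityʳ _ ⟨
        σ β * 1#                ≈⟨ *-congˡ ββ⁻¹≈1 ⟨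
        σ β * (β * β ⁻¹)        ≈⟨ solve 3 (λ s b i → s :* (b :* i) := (s :* i) :* b) refl (σ β) β (β ⁻¹) ⟩
        σ β * β ⁻¹ * β          ≈⟨ *-congʳ (*-congˡ σβ⁻¹≈β⁻¹) ⟨
        σ β * σ (β ⁻¹) * β      ≈⟨ *-congʳ (trans (sym (σ-homo-* β (β ⁻¹))) σ[ββ⁻¹]≈1) ⟩
        1# * β                  ≈⟨ *-identityˡ β ⟩
        β                       ∎

  Tr-condition≈β*[2#*4⁻¹] : σ γ ≈ γ → Tr q δ + Tr q γ * 4# ⁻¹ ≈ β * (2# * 4# ⁻¹)
  Tr-condition≈β*[2#*4⁻¹] σγ≈γ = begin
    Tr q δ + (γ + σ γ) * 4# ⁻¹                          ≈⟨ +-congˡ (*-congʳ (+-congˡ σγ≈γ)) ⟩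
    Tr q δ + (γ + γ) * 4# ⁻¹                            ≈⟨ +-congʳ (trans (*-congˡ 2#*[2#*4⁻¹]≈1) (*-identityʳ _)) ⟨
    Tr q δ * (2# * (2# * 4# ⁻¹)) + (γ + γ) * 4# ⁻¹
      ≈⟨ solve 3 (λ t g i → t :* (con (ℤ.+ 2) :* (con (ℤ.+ 2) :* i)) :+ (g :+ g) :* i
                            := ((t :+ t) :+ g) :* (con (ℤ.+ 2) :* i))
                 refl (Tr q δ) γ (4# ⁻¹) ⟩
    β * (2# * 4# ⁻¹)                                    ∎

  fixed-γ⇒injective : ¬ γ ≈ 0# → σ γ ≈ γ → ¬ β ≈ 0# → Injective _≈_ _≈_ f
  fixed-γ⇒injective γ≉0 σγ≈γ β≉0 {x} {y} fx≈fy = *-cancelˡ γ≉0 (+-cancelˡ (square (u x)) _ _ (begin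
    square (u x) + γ * x    ≈⟨ f-via-u x ⟨
    f x                     ≈⟨ fx≈fy ⟩
    f y                     ≈⟨ f-via-u y ⟩
    square (u y) + γ * y    ≈⟨ +-congʳ (square-cong (sym ux≈uy)) ⟩
    square (u x) + γ * y    ∎))
    where
    square : Carrier → Carrier
    square a = (σ δ - a) * (σ δ - a)
    square-cong : ∀ {a b} → a ≈ b → square a ≈ square b
    square-cong a≈b = *-cong (+-congˡ (-‿cong a≈b)) (+-congˡ (-‿cong a≈b))
    K : Carrier
    K = δ * δ - σ δ * σ δ
    ux≈uy : u x ≈ u y
    ux≈uy = *-cancelˡ β≉0 (trans (*-comm β (u x)) (trans (+-cancelˡ K _ _ (begin
      K + u x * β       ≈⟨ σf-f σγ≈γ x ⟨
      σ (f x) - f x     ≈⟨ +-cong (σ-cong fx≈fy) (-‿cong fx≈fy) ⟩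
      σ (f y) - f y     ≈⟨ σf-f σγ≈γ y ⟩
      K + u y * β       ∎)) (*-comm (u y) β)))

  Condition : Set ℓ
  Condition = σ γ ≈ γ Product.× ¬ (Tr q δ + Tr q γ * 4# ⁻¹ ≈ 0#)

  permutation⇒condition : IsPermutation f → Condition
  permutation⇒condition (f-inj , _) = σγ≈γ , λ condition≈0 →
    [ injective⇒β≉0 (f-inj _ _) , 2#*4⁻¹≉0 ]′
      (x*y≈0⇒x≈0⊎y≈0 (trans (sym (Tr-condition≈β*[2#*4⁻¹] σγ≈γ)) condition≈0))
    where
    σγ≈γ : σ γ ≈ γ
    σγ≈γ = injective⇒σγ≈γ (f-inj _ _)
    2#*4⁻¹≉0 : ¬ 2# * 4# ⁻¹ ≈ 0#
    2#*4⁻¹≉0 2#*4⁻¹≈0 = 1≉0 (trans (sym 2#*[2#*4⁻¹]≈1) (trans (*-congˡ 2#*4⁻¹≈0) (zeroʳ 2#)))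

  condition⇒permutation : ¬ γ ≈ 0# → Condition → IsPermutation f
  condition⇒permutation γ≉0 (σγ≈γ , condition≉0) = (λ _ _ → f-inj) , injective⇒surjective f-inj
    where
    β≉0 : ¬ β ≈ 0#
    β≉0 β≈0 = condition≉0 (trans (Tr-condition≈β*[2#*4⁻¹] σγ≈γ) (trans (*-congʳ β≈0) (zeroˡ _)))
    f-inj : Injective _≈_ _≈_ f
    f-inj = fixed-γ⇒injective γ≉0 σγ≈γ β≉0

-- Imported only here: Data.Nat's _^_ and Data.Product's _×_ would clash with the ring's _^_ and _×_
-- opened in the modules above.
open import Defs
open import Data.Nat using (ℕ; _^_)
import Data.Nat as ℕ
open import Data.Nat.Divisibility using (_∣_)
open import Data.Product using (_×_)
open import Relation.Nullary using (¬_)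
open import Function.Bundles using (_⇔_; mk⇔)

theorem3p3 : ∀ {c ℓ} (q : ℕ) → IsPrimePower q → ¬ (2 ∣ q) →
    (F : FiniteField c ℓ (q ^ 2)) →
    let open FiniteField F in
    (γ δ : Carrier) → ¬ (γ ≈ 0#) →
    IsPermutation (λ x → ((((x ^ᶠ q) - x) + δ) ^ᶠ (2 ℕ.* q)) + (γ * x))
      ⇔ (((γ ^ᶠ q) ≈ γ) × ¬ ((Tr q δ + (Tr q γ * (4# ⁻¹))) ≈ 0#))
theorem3p3 q (p , k , p-prime , q≡p^[1+k]) q-odd F γ δ γ≉0 =
  mk⇔ permutation⇒condition (condition⇒permutation γ≉0)
  where open PermutationCriterion {k = k} p-prime q≡p^[1+k] q-odd F γ δ
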